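{- Let $(S,F)$ be a set system with $S=\{s_1,\ldots,s_p\}$ and $F=\{C_1,\ldots,C_q\}$ a family of subsets of $S$, $q\le p$. Let $G$ be the graph with vertex set $A\cup B\cup Z\cup\{u,v,u'\}$, where $A=\{a_1,\ldots,a_p\}$, $B=\{b_1,\ldots,b_q\}$, $Z=\{z_1,\ldots,z_p\}$, and edges: $a_ib_j$ whenever $s_i\in C_j$; $a_iz_i$ for all $i\in\{1,\ldots,p\}$; $b_ju$ for all $j\in\{1,\ldots,q\}$; and $uv$, $vu'$. Then $(S,F)$ has a cover of size $t$ if and only if $G$ has a vertex-edge dominating set of size at most $t+1$.
   Context: A cover of $S$ in the set system $(S,F)$ is a subfamily $C\subseteq F$ such that every element of $S$ lies in some member of $C$. For a graph $G$, $N_G[x]$ denotes the closed neighbourhood of $x$; a set $D\subseteq V(G)$ is a vertex-edge dominating set if for every edge $xy\in E(G)$, $|(N_G[x]\cup N_G[y])\cap D|\ge 1$. (The graph $G$ is bipartite with parts $X=A\cup\{u,u'\}$ and $Y=B\cup Z\cup\{v\}$, and is star-convex with respect to the star on $X$ centred at $u$.) -}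

module Defs where

open import Data.Nat using (ℕ; _≤_; suc)
open import Data.Fin using (Fin)
open import Data.Fin.Subset using (Subset; _∈_; ∣_∣)
open import Data.Vec using (Vec; lookup)
open import Data.List using (List; length)
open import Data.List.Relation.Unary.Unique.Propositional using (Unique)
import Data.List.Membership.Propositional as L
open import Data.Product using (Σ; ∃; ∃-syntax; _×_)
open import Data.Sum using (_⊎_)
open import Relation.Binary.PropositionalEquality using (_≡_)

-- A set system (S,F): S = Fin p = {s_1..s_p}, F = (C_1,…,C_q) with C_j = lookup F j ⊆ S.
SetSystem : ℕ → ℕ → Set
SetSystem p q = Vec (Subset p) q

-- A subfamily C ⊆ F (given by the indices j of the chosen C_j) is a cover of S.
IsCover : ∀ {p q} → SetSystem p q → Subset q → Set
IsCover {p} F C = (i : Fin p) → ∃[ j ] (j ∈ C × i ∈ lookup F j)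

data V (p q : ℕ) : Set where
  a : Fin p → V p q
  b : Fin q → V p q
  z : Fin p → V p q
  u : V p q
  v : V p q
  u' : V p q

-- Edges of G (each undirected edge listed once, in one orientation).
data Edge {p q : ℕ} (F : SetSystem p q) : V p q → V p q → Set where
  ab  : ∀ i j → i ∈ lookup F j → Edge F (a i) (b j)
  az  : ∀ i → Edge F (a i) (z i)
  bu  : ∀ j → Edge F (b j) u
  uv  : Edge F u v
  vu' : Edge F v u'

InN : ∀ {p q} (F : SetSystem p q) → V p q → V p q → Set
InN F x w = (w ≡ x) ⊎ (Edge F x w ⊎ Edge F w x)

-- D is a vertex-edge dominating set of G: for every edge xy, (N[x] ∪ N[y]) ∩ D ≠ ∅.
-- D is a finite set of vertices given as a duplicate-free list; its size is its length.
IsVEDS : ∀ {p q} (F : SetSystem p q) → List (V p q) → Set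
IsVEDS {p} {q} F D =
  Unique D × ((x y : V p q) → Edge F x y →
               ∃[ w ] (w L.∈ D × (InN F x w ⊎ InN F y w)))

-- A cover C gives the dominating set {u} ∪ {b_j : j ∈ C}: u dominates every edge at u, v and
-- the b's, and the edges at a_i are dominated by any b_j with s_i ∈ C_j.  Conversely, send each
-- vertex of a dominating set D to one member of F: b_j to C_j, a_i and z_i to some set containing
-- s_i, and u, v, u' to nothing.  The edge a_i z_i forces a vertex of D sent to a set containing
-- s_i, so the images cover S; the edge v u' forces a vertex of D among u, v, u', so at most
-- |D| - 1 sets are used.
module Submission where

open import Defs
open import Data.Nat using (ℕ; _≤_; _<_; suc; _+_; z≤n; s≤s)
open import Data.Nat.Properties using (module ≤-Reasoning; ≤-trans; ≤-reflexive; +-mono-≤; +-monoʳ-≤; +-monoˡ-≤; +-suc; ≤-pred)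
open import Data.Fin using (Fin; zero; suc)
open import Data.Fin.Properties using (suc-injective)
open import Data.Fin.Subset using (Subset; _∈_; ∣_∣; ⊥; ⁅_⁆; _∪_; ⋃; inside; outside)
open import Data.Fin.Subset.Properties using (∣p∣≤∣x∷p∣; ∣⊥∣≡0; ∣⁅x⁆∣≡1; x∈⁅x⁆; p⊆p∪q; q⊆p∪q)
open import Data.Vec using (lookup; []; _∷_)
import Data.Vec as Vec
open import Data.List using (List; length; map; []; _∷_)
open import Data.List.Properties using (length-map)
open import Data.List.Relation.Unary.Any using (here; there)
import Data.List.Relation.Unary.All as All
import Data.List.Relation.Unary.All.Properties as All
import Data.List.Membership.Propositional as List
open import Data.List.Membership.Propositional.Properties using (∈-map⁺)
open import Data.List.Relation.Unary.Unique.Propositional using (Unique)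
open import Data.List.Relation.Unary.AllPairs using ([]; _∷_)
import Data.List.Relation.Unary.Unique.Propositional.Properties as Unique
open import Data.Product using (∃-syntax; _×_; _,_; proj₁; proj₂)
open import Data.Sum using (_⊎_; inj₁; inj₂)
open import Function.Bundles using (_⇔_; mk⇔)
open import Relation.Binary.PropositionalEquality using (_≡_; _≢_; refl; subst; sym; cong; trans)

private
  variable
    A B : Set
    n : ℕ

∣p∪q∣≤∣p∣+∣q∣ : (p q : Subset n) → ∣ p ∪ q ∣ ≤ ∣ p ∣ + ∣ q ∣
∣p∪q∣≤∣p∣+∣q∣ []            []            = z≤n
∣p∪q∣≤∣p∣+∣q∣ (inside ∷ p)  (s ∷ q)       = s≤s (≤-trans (∣p∪q∣≤∣p∣+∣q∣ p q) (+-monoʳ-≤ ∣ p ∣ (∣p∣≤∣x∷p∣ s q)))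
∣p∪q∣≤∣p∣+∣q∣ (outside ∷ p) (inside ∷ q)  = subst (suc ∣ p ∪ q ∣ ≤_) (sym (+-suc ∣ p ∣ ∣ q ∣)) (s≤s (∣p∪q∣≤∣p∣+∣q∣ p q))
∣p∪q∣≤∣p∣+∣q∣ (outside ∷ p) (outside ∷ q) = ∣p∪q∣≤∣p∣+∣q∣ p q

∈-⋃⁺ : ∀ {ps : List (Subset n)} {p i} → p List.∈ ps → i ∈ p → i ∈ ⋃ ps
∈-⋃⁺ {ps = p ∷ ps} (here refl) i∈p = p⊆p∪q (⋃ ps) i∈p
∈-⋃⁺ {ps = p ∷ ps} (there m)   i∈p = q⊆p∪q p (⋃ ps) (∈-⋃⁺ m i∈p)

module _ (g : A → Subset n) (∣g∣≤1 : ∀ x → ∣ g x ∣ ≤ 1) where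

  ∣⋃-map∣≤length : (xs : List A) → ∣ ⋃ (map g xs) ∣ ≤ length xs
  ∣⋃-map∣≤length []       = ≤-reflexive (∣⊥∣≡0 n)
  ∣⋃-map∣≤length (x ∷ xs) =
    ≤-trans (∣p∪q∣≤∣p∣+∣q∣ (g x) _) (+-mono-≤ (∣g∣≤1 x) (∣⋃-map∣≤length xs))

  ∣⋃-map∣<length : ∀ {x} (xs : List A) → x List.∈ xs → g x ≡ ⊥ → ∣ ⋃ (map g xs) ∣ < length xs
  ∣⋃-map∣<length (x ∷ xs) (here refl) gx≡⊥ = s≤s (begin
    ∣ g x ∪ ⋃ (map g xs) ∣        ≤⟨ ∣p∪q∣≤∣p∣+∣q∣ (g x) _ ⟩
    ∣ g x ∣ + ∣ ⋃ (map g xs) ∣    ≡⟨ cong (_+ _) (trans (cong ∣_∣ gx≡⊥) (∣⊥∣≡0 n)) ⟩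
    ∣ ⋃ (map g xs) ∣              ≤⟨ ∣⋃-map∣≤length xs ⟩
    length xs                     ∎)
    where open ≤-Reasoning
  ∣⋃-map∣<length (y ∷ xs) (there m)   gx≡⊥ =
    s≤s (≤-trans (∣p∪q∣≤∣p∣+∣q∣ (g y) _)
                 (≤-trans (+-monoˡ-≤ _ (∣g∣≤1 y)) (∣⋃-map∣<length xs m gx≡⊥)))

unique-∷-map : ∀ {f : A → B} {x} {xs} → (∀ {y z} → f y ≡ f z → y ≡ z) → (∀ y → x ≢ f y) →
               Unique xs → Unique (x ∷ map f xs)
unique-∷-map {xs = xs} f-inj x∉f xs! =
  All.map⁺ (All.universal x∉f xs) ∷ Unique.map⁺ f-inj xs!

elements : Subset n → List (Fin n)
elements []            = []
elements (inside ∷ p)  = zero ∷ map suc (elements p)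
elements (outside ∷ p) = map suc (elements p)

length-elements : (p : Subset n) → length (elements p) ≡ ∣ p ∣
length-elements []            = refl
length-elements (inside ∷ p)  = cong suc (trans (length-map suc (elements p)) (length-elements p))
  where open Relation.Binary.PropositionalEquality using (trans)
length-elements (outside ∷ p) = trans (length-map suc (elements p)) (length-elements p)
  where open Relation.Binary.PropositionalEquality using (trans)

∈-elements : ∀ (p : Subset n) {i} → i ∈ p → i List.∈ elements p
∈-elements (inside ∷ p)  Vec.here      = here refl
∈-elements (inside ∷ p)  (Vec.there m) = there (∈-map⁺ suc (∈-elements p m))
∈-elements (outside ∷ p) (Vec.there m) = ∈-map⁺ suc (∈-elements p m)

elements-unique : (p : Subset n) → Unique (elements p)
elements-unique []            = []
elements-unique (inside ∷ p)  = unique-∷-map suc-injective (λ _ ()) (elements-unique p)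
elements-unique (outside ∷ p) = Unique.map⁺ suc-injective (elements-unique p)

module _ {p q : ℕ} (F : SetSystem p q) where

  Dominates : List (V p q) → V p q → V p q → Set
  Dominates D x y = ∃[ w ] (w List.∈ D × (InN F x w ⊎ InN F y w))

  cover⇒veds : ∀ {t} → ∃[ C ] (IsCover F C × ∣ C ∣ ≤ t) → ∃[ D ] (IsVEDS F D × length D ≤ suc t)
  cover⇒veds {t} (C , cover , ∣C∣≤t) = D , (unique , dominates) , length-D
    where
    D : List (V p q)
    D = u ∷ map b (elements C)

    b-injective : ∀ {j k} → b {p} j ≡ b k → j ≡ k
    b-injective refl = refl

    unique : Unique D
    unique = unique-∷-map b-injective (λ _ ()) (elements-unique C)

    length-D : length D ≤ suc t
    length-D = s≤s (subst (_≤ _) (sym (trans (length-map b (elements C)) (length-elements C))) ∣C∣≤t)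

    via-a : ∀ i y → Dominates D (a i) y
    via-a i y with cover i
    ... | j , j∈C , i∈Cj = b j , there (∈-map⁺ b (∈-elements C j∈C)) , inj₁ (inj₂ (inj₁ (ab i j i∈Cj)))

    dominates : ∀ x y → Edge F x y → Dominates D x y
    dominates _ _ (ab i j _) = via-a i (b j)
    dominates _ _ (az i)     = via-a i (z i)
    dominates _ _ (bu j)     = u , here refl , inj₂ (inj₁ refl)
    dominates _ _ uv         = u , here refl , inj₁ (inj₁ refl)
    dominates _ _ vu'        = u , here refl , inj₁ (inj₂ (inj₂ uv))

  module _ (hit : (i : Fin p) → ∃[ j ] (i ∈ lookup F j)) where

    chosen : V p q → Subset q
    chosen (a i) = ⁅ proj₁ (hit i) ⁆
    chosen (b j) = ⁅ j ⁆
    chosen (z i) = ⁅ proj₁ (hit i) ⁆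
    chosen u     = ⊥
    chosen v     = ⊥
    chosen u'    = ⊥

    ∣chosen∣≤1 : ∀ w → ∣ chosen w ∣ ≤ 1
    ∣chosen∣≤1 (a i) = ≤-reflexive (∣⁅x⁆∣≡1 (proj₁ (hit i)))
    ∣chosen∣≤1 (b j) = ≤-reflexive (∣⁅x⁆∣≡1 j)
    ∣chosen∣≤1 (z i) = ≤-reflexive (∣⁅x⁆∣≡1 (proj₁ (hit i)))
    ∣chosen∣≤1 u     = subst (_≤ 1) (sym (∣⊥∣≡0 q)) z≤n
    ∣chosen∣≤1 v     = subst (_≤ 1) (sym (∣⊥∣≡0 q)) z≤n
    ∣chosen∣≤1 u'    = subst (_≤ 1) (sym (∣⊥∣≡0 q)) z≤n

    vu'-dominator-chooses-⊥ : ∀ {D} → Dominates D v u' → ∃[ w ] (w List.∈ D × chosen w ≡ ⊥)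
    vu'-dominator-chooses-⊥ (w , m , inj₁ (inj₁ refl))        = w , m , refl
    vu'-dominator-chooses-⊥ (w , m , inj₁ (inj₂ (inj₁ vu')))  = w , m , refl
    vu'-dominator-chooses-⊥ (w , m , inj₁ (inj₂ (inj₂ uv)))   = w , m , refl
    vu'-dominator-chooses-⊥ (w , m , inj₂ (inj₁ refl))        = w , m , refl
    vu'-dominator-chooses-⊥ (w , m , inj₂ (inj₂ (inj₂ vu')))  = w , m , refl

    az-dominator-covers : ∀ {D} i → Dominates D (a i) (z i) →
                          ∃[ w ] (w List.∈ D × ∃[ j ] (j ∈ chosen w × i ∈ lookup F j))
    az-dominator-covers i (w , m , inj₁ (inj₁ refl))              = w , m , _ , x∈⁅x⁆ _ , proj₂ (hit i)
    az-dominator-covers i (w , m , inj₁ (inj₂ (inj₁ (ab _ j s)))) = w , m , j , x∈⁅x⁆ j , s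
    az-dominator-covers i (w , m , inj₁ (inj₂ (inj₁ (az _))))     = w , m , _ , x∈⁅x⁆ _ , proj₂ (hit i)
    az-dominator-covers i (w , m , inj₂ (inj₁ refl))              = w , m , _ , x∈⁅x⁆ _ , proj₂ (hit i)
    az-dominator-covers i (w , m , inj₂ (inj₂ (inj₂ (az _))))     = w , m , _ , x∈⁅x⁆ _ , proj₂ (hit i)

    veds⇒cover : ∀ {t} → ∃[ D ] (IsVEDS F D × length D ≤ suc t) → ∃[ C ] (IsCover F C × ∣ C ∣ ≤ t)
    veds⇒cover {t} (D , (_ , dominates) , ∣D∣≤1+t) = C , cover , ∣C∣≤t
      where
      C : Subset q
      C = ⋃ (map chosen D)

      cover : IsCover F C
      cover i with az-dominator-covers i (dominates _ _ (az i))
      ... | w , w∈D , j , j∈w , i∈Cj = j , ∈-⋃⁺ (∈-map⁺ chosen w∈D) j∈w , i∈Cj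

      ∣C∣≤t : ∣ C ∣ ≤ t
      ∣C∣≤t with vu'-dominator-chooses-⊥ (dominates _ _ vu')
      ... | w , w∈D , w↦⊥ = ≤-pred (≤-trans (∣⋃-map∣<length chosen ∣chosen∣≤1 D w∈D w↦⊥) ∣D∣≤1+t)

lemma4 : (p q : ℕ) → (F : SetSystem p q) → q ≤ p →
         ((i : Fin p) → ∃[ j ] (i ∈ lookup F j)) →
         (t : ℕ) →
         (∃[ C ] (IsCover F C × ∣ C ∣ ≤ t)) ⇔
         (∃[ D ] (IsVEDS F D × length D ≤ suc t))
lemma4 p q F _ hit t = mk⇔ (cover⇒veds F) (veds⇒cover F hit)
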